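{- Let $g\ge2$ and $q_1,\ldots,q_g$, $D$ be as in the context. For a prime $p$ with $p\nmid D$ define $$\omega(p) := p\sum_{\substack{c_1\mid p,\ldots,c_g\mid p\\ p\mid c_1\cdots c_g}}\mu(p)\mu(c_1)\cdots\mu(c_g)\frac{\rho(c_1,\ldots,c_g)}{(c_1\cdots c_g)^2}.$$ Then for every prime $p\nmid D$, $$\omega(p) = p^{ -1}\Big(\sum_{i=1}^g\rho(\mathbf{e}^{(i)}) + 1 - g\Big),$$ where $\mathbf{e}^{(i)}$ is the $g$-tuple with $p$ in position $i$ and $1$ in all other positions.
   Context: $q_i(x,y)=a_ix^2+2b_ixy+c_iy^2$ ($i=1,\ldots,g$) are integer binary quadratic forms, irreducible over the integers, with $a_i\equiv 1\pmod 4$; $\delta_i$ is the discriminant of $q_i$ and $\mathrm{Res}(q_i,q_j)$ the resultant; $D:=\prod_{p\le 2g}p\prod_k a_kc_k\delta_k\prod_{i<j}\mathrm{Res}(q_i,q_j)\neq 0$. $\mu$ is the Möbius function. For positive integers $\mathbf{d}=(d_1,\ldots,d_g)$, $\rho(\mathbf{d}):=\#\{\mathbf{x}\in\mathbb{Z}^2\cap[0,d_1\cdots d_g)^2 : d_i\mid q_i(\mathbf{x}),\ i=1,\ldots,g\}$. -}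

module Defs where

open import Data.Bool using (Bool; true; false; if_then_else_; _∧_)
open import Data.Nat as ℕ using (ℕ; zero; suc)
open import Data.Nat.Divisibility using (_∣?_)
open import Data.Nat.Primality using (prime?)
open import Data.Integer as ℤ using (ℤ; +_; ∣_∣)
open import Data.Integer.Divisibility using (_∣_)
open import Data.Rational as ℚ using (ℚ; 0ℚ; _/_)
open import Data.Fin using (Fin)
open import Data.Vec as Vec using (Vec; []; _∷_; lookup; replicate; _[_]≔_)
open import Data.List as List using (List; [_]; upTo; applyUpTo; filter; concatMap; allFin)
open import Data.Nat.ListAction using () renaming (sum to sumN)
open import Data.Bool.ListAction using () renaming (any to anyB)
open import Data.Product using (Σ; _×_; ∃)
open import Relation.Binary.PropositionalEquality using (_≡_)
open import Relation.Nullary using (¬_)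
open import Relation.Nullary.Decidable using (⌊_⌋)

-- Integer binary quadratic form  a x² + 2 b x y + c y²
record BQF : Set where
  constructor bqf
  field
    a b c : ℤ
open BQF public

eval : BQF → ℤ → ℤ → ℤ
eval q x y = a q ℤ.* x ℤ.* x ℤ.+ (+ 2) ℤ.* b q ℤ.* x ℤ.* y ℤ.+ c q ℤ.* y ℤ.* y

-- discriminant of a x² + (2b) x y + c y², i.e. (2b)² - 4ac
disc : BQF → ℤ
disc q = (+ 4) ℤ.* (b q ℤ.* b q ℤ.- a q ℤ.* c q)

-- resultant of A₁x²+B₁xy+C₁y² and A₂x²+B₂xy+C₂y² (here B = 2b):
-- (A₁C₂ - A₂C₁)² - (A₁B₂ - A₂B₁)(B₁C₂ - B₂C₁)
res : BQF → BQF → ℤ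
res q r = (A₁ ℤ.* C₂ ℤ.- A₂ ℤ.* C₁) ℤ.* (A₁ ℤ.* C₂ ℤ.- A₂ ℤ.* C₁)
          ℤ.- (A₁ ℤ.* B₂ ℤ.- A₂ ℤ.* B₁) ℤ.* (B₁ ℤ.* C₂ ℤ.- B₂ ℤ.* C₁)
  where
  A₁ = a q ; B₁ = (+ 2) ℤ.* b q ; C₁ = c q
  A₂ = a r ; B₂ = (+ 2) ℤ.* b r ; C₂ = c r

-- irreducible in ℤ[x,y]: not a product of two integer linear forms,
-- and no non-unit integer constant divides it (primitive).
Irreducible : BQF → Set
Irreducible q =
  (¬ (Σ ℤ λ r → Σ ℤ λ s → Σ ℤ λ t → Σ ℤ λ u →
        (a q ≡ r ℤ.* t) × ((+ 2) ℤ.* b q ≡ r ℤ.* u ℤ.+ s ℤ.* t) × (c q ≡ s ℤ.* u)))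
  × (∀ (n : ℤ) → n ∣ a q → n ∣ ((+ 2) ℤ.* b q) → n ∣ c q → ∣ n ∣ ≡ 1)

primorial : ℕ → ℕ
primorial zero = 1
primorial (suc n) = (if ⌊ prime? (suc n) ⌋ then suc n else 1) ℕ.* primorial n

prodZ : List ℤ → ℤ
prodZ = List.foldr ℤ._*_ (+ 1)

sumZ : List ℤ → ℤ
sumZ = List.foldr ℤ._+_ (+ 0)

acdProd : ∀ {g} → Vec BQF g → ℤ
acdProd [] = + 1
acdProd (q ∷ qs) = a q ℤ.* c q ℤ.* disc q ℤ.* acdProd qs

resProd : ∀ {g} → Vec BQF g → ℤ
resProd [] = + 1
resProd (q ∷ qs) = prodZ (List.map (res q) (Vec.toList qs)) ℤ.* resProd qs

D : (g : ℕ) → Vec BQF g → ℤ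
D g qs = (+ primorial (2 ℕ.* g)) ℤ.* acdProd qs ℤ.* resProd qs

prodV : ∀ {g} → Vec ℕ g → ℕ
prodV = Vec.foldr _ ℕ._*_ 1

divB : ℕ → ℤ → Bool
divB d z = ⌊ d ∣? ∣ z ∣ ⌋

allDiv : ∀ {g} → Vec BQF g → Vec ℕ g → ℤ → ℤ → Bool
allDiv [] [] x y = true
allDiv (q ∷ qs) (d ∷ ds) x y = divB d (eval q x y) ∧ allDiv qs ds x y

ρ : ∀ {g} → Vec BQF g → Vec ℕ g → ℕ
ρ qs ds = sumN (concatMap (λ x → List.map (λ y →
            if allDiv qs ds (+ x) (+ y) then 1 else 0) (upTo N)) (upTo N))
  where N = prodV ds

μ : ℕ → ℤ
μ n = if anyB (λ d → ⌊ (d ℕ.* d) ∣? n ⌋) (applyUpTo (λ k → suc (suc k)) n)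
      then + 0
      else (ℤ.- (+ 1)) ℤ.^ List.length (filter (λ d → prime? d) (filter (λ d → d ∣? n) (applyUpTo suc n)))

divisors : ℕ → List ℕ
divisors n = filter (λ d → d ∣? n) (applyUpTo suc n)

tuples : (g : ℕ) → List ℕ → List (Vec ℕ g)
tuples zero L = [ [] ]
tuples (suc g) L = concatMap (λ x → List.map (x ∷_) (tuples g L)) L

-- z / n as a rational (n is always positive where used; 0 for n = 0)
frac : ℤ → ℕ → ℚ
frac z zero = 0ℚ
frac z (suc n) = z / suc n

sumQ : List ℚ → ℚ
sumQ = List.foldr ℚ._+_ 0ℚ

ω : ∀ {g} → Vec BQF g → ℕ → ℚ
ω {g} qs p = (+ p / 1) ℚ.* sumQ (List.map term
               (filter (λ cs → p ∣? prodV cs) (tuples g (divisors p))))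
  where
  term : Vec ℕ g → ℚ
  term cs = frac (μ p ℤ.* Vec.foldr _ ℤ._*_ (+ 1) (Vec.map μ cs) ℤ.* (+ ρ qs cs))
                 (prodV cs ℕ.* prodV cs)

e : (g : ℕ) → Fin g → ℕ → Vec ℕ g
e g i p = replicate g 1 [ i ]≔ p

{-# OPTIONS --safe #-}
-- For a prime p the c_i range over {1, p}, so a tuple c is determined by its support s ⊆ {1, …, g}, and
-- p ∣ c₁⋯c_g says s ≠ ∅.  A singleton s = {i} contributes ρ(e⁽ⁱ⁾)/p.  If |s| = k ≥ 2, two forms q_i, q_j with
-- p ∤ Res(q_i, q_j) vanish mod p at (x, y); since Res(q_i, q_j)·x³ and Res(q_i, q_j)·y³ lie in the ideal
-- (q_i, q_j), this forces p ∣ x and p ∣ y.  Hence ρ(c) = p^(2k-2) and the contribution is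
-- μ(p)(-1)^k/p = -(-1)^k/p, and Σ_{|s| ≥ 2} -(-1)^|s| = 1 - g.
module Submission where

open import Defs
open import Data.Nat using (ℕ; _≤_)
open import Data.Nat.Primality using (Prime)
open import Data.Integer as ℤ using (ℤ; +_; _-_; _+_)
open import Data.Integer.Divisibility using (_∣_)
open import Data.Fin using (Fin)
open import Data.Vec using (Vec; lookup)
open import Data.List using (map; allFin)
open import Relation.Binary.PropositionalEquality using (_≡_; _≢_)
open import Relation.Nullary using (¬_)

open import Data.Bool using (Bool; true; false; T; if_then_else_; _∧_)
open import Data.Bool.ListAction using () renaming (any to anyB)
open import Data.Bool.Properties using (T-≡)
open import Data.Empty using (⊥-elim)
open import Data.Fin using (zero; suc)
open import Data.Fin.Subset using (Subset; ⁅_⁆; ⊥; inside; outside) renaming (∣_∣ to card)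
open import Data.Integer using (0ℤ; 1ℤ; -1ℤ; -_; _*_)
import Data.Integer.Properties as ℤ
import Data.Integer.Divisibility.Signed as ℤ∣
open import Data.Integer.Tactic.RingSolver using (solve-∀)
open import Data.List as List using (List; []; _∷_; _++_; _∷ʳ_; applyUpTo; upTo; concatMap; filter)
import Data.List.Properties as List
open import Data.List.Relation.Unary.All as All using (All)
import Data.List.Relation.Unary.All.Properties as All
import Data.List.Relation.Unary.Any.Properties as Any
open import Data.Nat as ℕ using (zero; suc; NonZero)
import Data.Nat.Properties as ℕ
open import Data.Nat.Divisibility as ℕ∣ using (_∣?_)
open import Data.Nat.ListAction using () renaming (sum to sumN)
import Data.Nat.ListAction.Properties as sumN
open import Data.Nat.Primality using (euclidsLemma; prime; composite; prime?; ¬prime[1]; prime⇒nonZero; prime⇒nonTrivial)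
open import Data.Product using (_×_; _,_; proj₁; proj₂)
open import Data.Rational as ℚ using (ℚ; 0ℚ; _/_; toℚᵘ)
import Data.Rational.Properties as ℚ
open import Data.Rational.Unnormalised as ℚᵘ using (mkℚᵘ; *≡*)
import Data.Rational.Unnormalised.Properties as ℚᵘ
open import Data.Sum using (_⊎_; inj₁; inj₂)
import Data.Vec.Properties as Vec
open import Data.Vec as Vec using (_∷_)
open import Function using (_∘_; _⇔_; mk⇔; Equivalence)
open import Level using (0ℓ)
open import Relation.Binary.PropositionalEquality using (refl; sym; trans; cong; cong₂; subst; module ≡-Reasoning)
open import Relation.Nullary using (does)
open import Relation.Nullary.Decidable using (Dec; yes; no; ⌊_⌋; isYes≗does; does-⇔; dec-true; dec-false; toWitness)
open import Relation.Unary using (Pred; Decidable)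

frac-0 : ∀ n .{{_ : NonZero n}} → frac 0ℤ n ≡ 0ℚ
frac-0 n@(suc _) = ℚ.0/n≡0 n

frac-+ : ∀ z w n .{{_ : NonZero n}} → frac z n ℚ.+ frac w n ≡ frac (z + w) n
frac-+ z w n@(suc n-1) = ℚ.toℚᵘ-injective (begin
  toℚᵘ (frac z n ℚ.+ frac w n)                    ≈⟨ ℚ.toℚᵘ-homo-+ (frac z n) (frac w n) ⟩
  toℚᵘ (frac z n) ℚᵘ.+ toℚᵘ (frac w n)            ≈⟨ ℚᵘ.+-cong (ℚ.toℚᵘ-fromℚᵘ (mkℚᵘ z n-1)) (ℚ.toℚᵘ-fromℚᵘ (mkℚᵘ w n-1)) ⟩
  mkℚᵘ z n-1 ℚᵘ.+ mkℚᵘ w n-1                      ≈⟨ *≡* same-denominator ⟩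
  mkℚᵘ (z + w) n-1                                ≈⟨ ℚᵘ.≃-sym (ℚ.toℚᵘ-fromℚᵘ (mkℚᵘ (z + w) n-1)) ⟩
  toℚᵘ (frac (z + w) n)                           ∎)
  where
  open ℚᵘ.≃-Reasoning
  same-denominator : (z * + n + w * + n) * + n ≡ (z + w) * + (n ℕ.* n)
  same-denominator = trans (distrib z w (+ n)) (cong ((z + w) *_) (sym (ℤ.pos-* n n)))
    where
    distrib : ∀ a b c → (a * c + b * c) * c ≡ (a + b) * (c * c)
    distrib = solve-∀

frac-*-cancelʳ : ∀ z k n .{{_ : NonZero k}} .{{_ : NonZero n}} → frac (z * + k) (n ℕ.* k) ≡ frac z n
frac-*-cancelʳ z k@(suc k-1) n@(suc n-1) = ℚ.fromℚᵘ-cong {mkℚᵘ (z * + k) _} {mkℚᵘ z n-1} (*≡* cancel)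
  where
  cancel : (z * + k) * + n ≡ z * + (n ℕ.* k)
  cancel = trans (reassoc z (+ k) (+ n)) (cong (z *_) (sym (ℤ.pos-* n k)))
    where
    reassoc : ∀ a b c → (a * b) * c ≡ a * (c * b)
    reassoc = solve-∀

*-frac-cancelˡ : ∀ z m n .{{_ : NonZero m}} .{{_ : NonZero n}} →
                 (+ m / 1) ℚ.* frac z (m ℕ.* n) ≡ frac z n
*-frac-cancelˡ z m@(suc m-1) n@(suc n-1) = ℚ.toℚᵘ-injective (begin
  toℚᵘ ((+ m / 1) ℚ.* frac z (m ℕ.* n))          ≈⟨ ℚ.toℚᵘ-homo-* (+ m / 1) (frac z (m ℕ.* n)) ⟩
  toℚᵘ (+ m / 1) ℚᵘ.* toℚᵘ (frac z (m ℕ.* n))    ≈⟨ ℚᵘ.*-cong (ℚ.toℚᵘ-fromℚᵘ (mkℚᵘ (+ m) 0)) (ℚ.toℚᵘ-fromℚᵘ (mkℚᵘ z _)) ⟩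
  mkℚᵘ (+ m) 0 ℚᵘ.* mkℚᵘ z _                     ≈⟨ *≡* cancel ⟩
  mkℚᵘ z n-1                                      ≈⟨ ℚᵘ.≃-sym (ℚ.toℚᵘ-fromℚᵘ (mkℚᵘ z n-1)) ⟩
  toℚᵘ (frac z n)                                 ∎)
  where
  open ℚᵘ.≃-Reasoning
  cancel : (+ m * z) * + n ≡ z * + (1 ℕ.* (m ℕ.* n))
  cancel = trans (commute (+ m) z (+ n))
                 (cong (z *_) (trans (sym (ℤ.pos-* m n)) (cong +_ (sym (ℕ.*-identityˡ (m ℕ.* n))))))
    where
    commute : ∀ a b c → (a * b) * c ≡ b * (a * c)
    commute = solve-∀

sumQ-frac : ∀ {A : Set} (f : A → ℤ) n .{{_ : NonZero n}} (xs : List A) →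
            sumQ (map (λ x → frac (f x) n) xs) ≡ frac (sumZ (map f xs)) n
sumQ-frac f n []       = sym (frac-0 n)
sumQ-frac f n (x ∷ xs) = trans (cong (frac (f x) n ℚ.+_) (sumQ-frac f n xs)) (frac-+ (f x) _ n)

sumQ-filter : ∀ {A : Set} {P : Pred A 0ℓ} (P? : Decidable P) (t : A → ℚ) xs →
  sumQ (map t (filter P? xs)) ≡ sumQ (map (λ x → if does (P? x) then t x else 0ℚ) xs)
sumQ-filter P? t []       = refl
sumQ-filter P? t (x ∷ xs) with does (P? x)
... | true  = cong (t x ℚ.+_) (sumQ-filter P? t xs)
... | false = trans (sumQ-filter P? t xs) (sym (ℚ.+-identityˡ _))

sumZ-++ : ∀ xs ys → sumZ (xs ++ ys) ≡ sumZ xs + sumZ ys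
sumZ-++ []       ys = sym (ℤ.+-identityˡ (sumZ ys))
sumZ-++ (x ∷ xs) ys = trans (cong (_+_ x) (sumZ-++ xs ys)) (sym (ℤ.+-assoc x (sumZ xs) (sumZ ys)))

sumZ-map-+ : ∀ {A : Set} (f h : A → ℤ) xs →
             sumZ (map (λ x → f x + h x) xs) ≡ sumZ (map f xs) + sumZ (map h xs)
sumZ-map-+ f h []       = refl
sumZ-map-+ f h (x ∷ xs) = trans (cong (_+_ (f x + h x)) (sumZ-map-+ f h xs))
                                (interchange (f x) (h x) (sumZ (map f xs)) (sumZ (map h xs)))
  where
  interchange : ∀ a b c d → a + b + (c + d) ≡ a + c + (b + d)
  interchange = solve-∀

sumZ-map-neg : ∀ {A : Set} (f : A → ℤ) xs → sumZ (map (λ x → - f x) xs) ≡ - sumZ (map f xs)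
sumZ-map-neg f []       = refl
sumZ-map-neg f (x ∷ xs) = trans (cong (_+_ (- f x)) (sumZ-map-neg f xs)) (sym (ℤ.neg-distrib-+ (f x) _))

sumZ-map-0 : ∀ {A : Set} (xs : List A) → sumZ (map (λ _ → 0ℤ) xs) ≡ 0ℤ
sumZ-map-0 []       = refl
sumZ-map-0 (x ∷ xs) = trans (ℤ.+-identityˡ _) (sumZ-map-0 xs)

sumZ-map-1 : ∀ {A : Set} (xs : List A) → sumZ (map (λ _ → 1ℤ) xs) ≡ + List.length xs
sumZ-map-1 []       = refl
sumZ-map-1 (x ∷ xs) = cong (_+_ 1ℤ) (sumZ-map-1 xs)

map-allFin-suc : ∀ {A : Set} {n} (f : Fin (suc n) → A) → map f (allFin (suc n)) ≡ f zero ∷ map (f ∘ suc) (allFin n)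
map-allFin-suc f = cong (f zero ∷_) (trans (List.map-tabulate suc f) (sym (List.map-tabulate (λ i → i) (f ∘ suc))))

subsets : ∀ n → List (Subset n)
subsets zero    = Vec.[] ∷ []
subsets (suc n) = map (outside ∷_) (subsets n) ++ map (inside ∷_) (subsets n)

sumZ-subsets-suc : ∀ n (F : Subset (suc n) → ℤ) →
  sumZ (map F (subsets (suc n))) ≡ sumZ (map (F ∘ (outside ∷_)) (subsets n)) + sumZ (map (F ∘ (inside ∷_)) (subsets n))
sumZ-subsets-suc n F = begin
  sumZ (map F (map (outside ∷_) S ++ map (inside ∷_) S))
    ≡⟨ cong sumZ (List.map-++ F (map (outside ∷_) S) _) ⟩
  sumZ (map F (map (outside ∷_) S) ++ map F (map (inside ∷_) S))
    ≡⟨ sumZ-++ (map F (map (outside ∷_) S)) _ ⟩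
  sumZ (map F (map (outside ∷_) S)) + sumZ (map F (map (inside ∷_) S))
    ≡⟨ sym (cong₂ (λ xs ys → sumZ xs + sumZ ys) (List.map-∘ S) (List.map-∘ S)) ⟩
  sumZ (map (F ∘ (outside ∷_)) S) + sumZ (map (F ∘ (inside ∷_)) S) ∎
  where
  open ≡-Reasoning
  S = subsets n

sumZ-subsets-empty : ∀ n (h : Subset n → ℤ) →
  sumZ (map (λ s → if card s ℕ.≡ᵇ 0 then h s else 0ℤ) (subsets n)) ≡ h ⊥
sumZ-subsets-empty zero    h = ℤ.+-identityʳ (h Vec.[])
sumZ-subsets-empty (suc n) h = begin
  _ ≡⟨ sumZ-subsets-suc n (λ s → if card s ℕ.≡ᵇ 0 then h s else 0ℤ) ⟩
  _ ≡⟨ cong₂ _+_ (sumZ-subsets-empty n (h ∘ (outside ∷_))) (sumZ-map-0 (subsets n)) ⟩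
  h ⊥ + 0ℤ ≡⟨ ℤ.+-identityʳ (h ⊥) ⟩
  h ⊥ ∎
  where open ≡-Reasoning

sumZ-subsets-singleton : ∀ n (h : Subset n → ℤ) →
  sumZ (map (λ s → if card s ℕ.≡ᵇ 1 then h s else 0ℤ) (subsets n)) ≡ sumZ (map (h ∘ ⁅_⁆) (allFin n))
sumZ-subsets-singleton zero    h = refl
sumZ-subsets-singleton (suc n) h = begin
  _ ≡⟨ sumZ-subsets-suc n (λ s → if card s ℕ.≡ᵇ 1 then h s else 0ℤ) ⟩
  _ ≡⟨ cong₂ _+_ (sumZ-subsets-singleton n (h ∘ (outside ∷_))) (sumZ-subsets-empty n (h ∘ (inside ∷_))) ⟩
  sumZ (map (h ∘ ⁅_⁆ ∘ suc) (allFin n)) + h ⁅ zero ⁆ ≡⟨ ℤ.+-comm (sumZ (map (h ∘ ⁅_⁆ ∘ suc) (allFin n))) _ ⟩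
  h ⁅ zero ⁆ + sumZ (map (h ∘ ⁅_⁆ ∘ suc) (allFin n)) ≡⟨ cong sumZ (sym (map-allFin-suc (h ∘ ⁅_⁆))) ⟩
  sumZ (map (h ∘ ⁅_⁆) (allFin (suc n))) ∎
  where open ≡-Reasoning

sign≥2 : ℕ → ℤ
sign≥2 k@(suc (suc _)) = - (-1ℤ ℤ.^ k)
sign≥2 _               = 0ℤ

sign≥2-suc : ∀ k → sign≥2 (suc k) ≡ - sign≥2 k - (if k ℕ.≡ᵇ 1 then 1ℤ else 0ℤ)
sign≥2-suc zero          = refl
sign≥2-suc (suc zero)    = refl
sign≥2-suc (suc (suc k)) = flip (-1ℤ ℤ.^ suc (suc k))
  where
  flip : ∀ x → - (-1ℤ * x) ≡ - - x - 0ℤ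
  flip = solve-∀

sumZ-subsets-sign≥2 : ∀ n → sumZ (map (sign≥2 ∘ card) (subsets (suc n))) ≡ - + n
sumZ-subsets-sign≥2 n = begin
  sumZ (map (sign≥2 ∘ card) (subsets (suc n)))
    ≡⟨ sumZ-subsets-suc n (sign≥2 ∘ card) ⟩
  Σsign + sumZ (map (sign≥2 ∘ suc ∘ card) S)
    ≡⟨ cong (_+_ Σsign) (cong sumZ (List.map-cong (sign≥2-suc ∘ card) S)) ⟩
  Σsign + sumZ (map (λ s → - sign≥2 (card s) - singleton s) S)
    ≡⟨ cong (_+_ Σsign) (sumZ-map-+ (λ s → - sign≥2 (card s)) (λ s → - singleton s) S) ⟩
  Σsign + (sumZ (map (λ s → - sign≥2 (card s)) S) + sumZ (map (λ s → - singleton s) S))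
    ≡⟨ cong (_+_ Σsign) (cong₂ _+_ (sumZ-map-neg (sign≥2 ∘ card) S) (sumZ-map-neg singleton S)) ⟩
  Σsign + (- Σsign + - sumZ (map singleton S))
    ≡⟨ cancel Σsign (sumZ (map singleton S)) ⟩
  - sumZ (map singleton S)
    ≡⟨ cong -_ (trans (sumZ-subsets-singleton n (λ _ → 1ℤ)) (sumZ-map-1 (allFin n))) ⟩
  - + List.length (allFin n)
    ≡⟨ cong (λ k → - + k) (List.length-tabulate (λ i → i)) ⟩
  - + n ∎
  where
  open ≡-Reasoning
  S = subsets n
  Σsign = sumZ (map (sign≥2 ∘ card) S)
  singleton : Subset n → ℤ
  singleton s = if card s ℕ.≡ᵇ 1 then 1ℤ else 0ℤ
  cancel : ∀ a b → a + (- a + - b) ≡ - b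
  cancel = solve-∀

-- p² times the summand of ω(p) at a tuple with k entries p and ρ-value z; for k ≥ 2 that ρ-value is
-- forced to be p^(2k-2) and cancels, which is why z is then ignored.
weight : ℕ → ℤ → ℤ
weight k z = (if k ℕ.≡ᵇ 1 then z else 0ℤ) + sign≥2 k

sumZ-subsets-weight : ∀ n (h : Subset (suc n) → ℤ) →
  sumZ (map (λ s → weight (card s) (h s)) (subsets (suc n)))
  ≡ sumZ (map (h ∘ ⁅_⁆) (allFin (suc n))) + + 1 - + suc n
sumZ-subsets-weight n h = begin
  _ ≡⟨ sumZ-map-+ (λ s → if card s ℕ.≡ᵇ 1 then h s else 0ℤ) (sign≥2 ∘ card) (subsets (suc n)) ⟩
  _ ≡⟨ cong₂ _+_ (sumZ-subsets-singleton (suc n) h) (sumZ-subsets-sign≥2 n) ⟩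
  Σh + - + n ≡⟨ rearrange Σh (+ n) ⟩
  Σh + + 1 - + suc n ∎
  where
  open ≡-Reasoning
  Σh = sumZ (map (h ∘ ⁅_⁆) (allFin (suc n)))
  rearrange : ∀ a m → a + - m ≡ a + 1ℤ - (1ℤ + m)
  rearrange = solve-∀

⌊⌋-true : ∀ {A : Set} (a? : Dec A) → A → ⌊ a? ⌋ ≡ true
⌊⌋-true a? a = trans (isYes≗does a?) (dec-true a? a)

⌊⌋-false : ∀ {A : Set} (a? : Dec A) → ¬ A → ⌊ a? ⌋ ≡ false
⌊⌋-false a? ¬a = trans (isYes≗does a?) (dec-false a? ¬a)

⌊⌋-⇔ : ∀ {A B : Set} → A ⇔ B → (a? : Dec A) (b? : Dec B) → ⌊ a? ⌋ ≡ ⌊ b? ⌋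
⌊⌋-⇔ A⇔B a? b? = trans (isYes≗does a?) (trans (does-⇔ A⇔B a? b?) (sym (isYes≗does b?)))

¬T⇒≡false : ∀ {b} → ¬ T b → b ≡ false
¬T⇒≡false {false} _  = refl
¬T⇒≡false {true}  ¬T = ⊥-elim (¬T _)

countWhere : (ℕ → Bool) → List ℕ → ℕ
countWhere P xs = sumN (map (λ x → if P x then 1 else 0) xs)

countWhere-++ : ∀ P xs ys → countWhere P (xs ++ ys) ≡ countWhere P xs ℕ.+ countWhere P ys
countWhere-++ P xs ys = trans (cong sumN (List.map-++ _ xs ys)) (sumN.sum-++ (map _ xs) _)

countWhere-map : ∀ P f xs → countWhere P (map f xs) ≡ countWhere (P ∘ f) xs
countWhere-map P f xs = cong sumN (sym (List.map-∘ xs))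

countWhere-cong : ∀ {P Q} → (∀ x → P x ≡ Q x) → ∀ xs → countWhere P xs ≡ countWhere Q xs
countWhere-cong P≗Q xs = cong sumN (List.map-cong (λ x → cong (λ b → if b then 1 else 0) (P≗Q x)) xs)

countWhere-none : ∀ P {xs} → All (λ x → P x ≡ false) xs → countWhere P xs ≡ 0
countWhere-none P All.[]           = refl
countWhere-none P (Px≡false All.∷ rest) rewrite Px≡false = countWhere-none P rest

applyUpTo-+ : ∀ {A : Set} (f : ℕ → A) m n → applyUpTo f (m ℕ.+ n) ≡ applyUpTo f m ++ applyUpTo (f ∘ (m ℕ.+_)) n
applyUpTo-+ f zero    n = refl
applyUpTo-+ f (suc m) n = cong (f 0 ∷_) (applyUpTo-+ (f ∘ suc) m n)

multipleOf : ℕ → ℕ → Bool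
multipleOf d x = ⌊ d ∣? x ⌋

countWhere-multipleOf-upTo : ∀ d .{{_ : NonZero d}} k → countWhere (multipleOf d) (upTo (k ℕ.* d)) ≡ k
countWhere-multipleOf-upTo d        zero    = refl
countWhere-multipleOf-upTo d@(suc d-1) (suc k) = begin
  countWhere (multipleOf d) (upTo (d ℕ.+ k ℕ.* d))
    ≡⟨ cong (countWhere (multipleOf d)) (applyUpTo-+ (λ x → x) d (k ℕ.* d)) ⟩
  countWhere (multipleOf d) (upTo d ++ applyUpTo (d ℕ.+_) (k ℕ.* d))
    ≡⟨ countWhere-++ (multipleOf d) (upTo d) _ ⟩
  countWhere (multipleOf d) (upTo d) ℕ.+ countWhere (multipleOf d) (applyUpTo (d ℕ.+_) (k ℕ.* d))
    ≡⟨ cong₂ ℕ._+_ first-block shifted ⟩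
  1 ℕ.+ k ∎
  where
  open ≡-Reasoning
  first-block : countWhere (multipleOf d) (upTo d) ≡ 1
  first-block rewrite ⌊⌋-true (d ∣? 0) (d ℕ∣.∣0) =
    cong suc (countWhere-none (multipleOf d) (All.applyUpTo⁺₁ suc d-1 (λ {i} i<d-1 →
      ⌊⌋-false (d ∣? suc i) (ℕ∣.>⇒∤ (ℕ.s≤s i<d-1)))))
  shifted : countWhere (multipleOf d) (applyUpTo (d ℕ.+_) (k ℕ.* d)) ≡ k
  shifted = begin
    countWhere (multipleOf d) (applyUpTo (d ℕ.+_) (k ℕ.* d))
      ≡⟨ cong (countWhere (multipleOf d)) (sym (List.map-upTo (d ℕ.+_) (k ℕ.* d))) ⟩
    countWhere (multipleOf d) (map (d ℕ.+_) (upTo (k ℕ.* d)))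
      ≡⟨ countWhere-map (multipleOf d) (d ℕ.+_) (upTo (k ℕ.* d)) ⟩
    countWhere (multipleOf d ∘ (d ℕ.+_)) (upTo (k ℕ.* d))
      ≡⟨ countWhere-cong (λ x → ⌊⌋-⇔ (mk⇔ (λ d∣d+x → ℕ∣.∣m+n∣m⇒∣n d∣d+x ℕ∣.∣-refl) (ℕ∣.∣m∣n⇒∣m+n ℕ∣.∣-refl)) (d ∣? _) (d ∣? x)) (upTo (k ℕ.* d)) ⟩
    countWhere (multipleOf d) (upTo (k ℕ.* d))
      ≡⟨ countWhere-multipleOf-upTo d k ⟩
    k ∎

sumN-grid-∧ : ∀ (P Q : ℕ → Bool) xs ys →
  sumN (concatMap (λ x → map (λ y → if P x ∧ Q y then 1 else 0) ys) xs) ≡ countWhere P xs ℕ.* countWhere Q ys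
sumN-grid-∧ P Q []       ys = refl
sumN-grid-∧ P Q (x ∷ xs) ys with P x
... | true  = trans (sumN.sum-++ (map _ ys) _) (cong (countWhere Q ys ℕ.+_) (sumN-grid-∧ P Q xs ys))
... | false = trans (sumN.sum-++ (map _ ys) _)
                    (cong₂ ℕ._+_ (countWhere-none (λ _ → false) (All.universal (λ _ → refl) ys)) (sumN-grid-∧ P Q xs ys))

ρ-square : ∀ {g} (qs : Vec BQF g) ds (P : ℕ → Bool) → (∀ x y → allDiv qs ds (+ x) (+ y) ≡ P x ∧ P y) →
           ρ qs ds ≡ countWhere P (upTo (prodV ds)) ℕ.* countWhere P (upTo (prodV ds))
ρ-square qs ds P allDiv≡ = trans
  (cong sumN (List.concatMap-cong (λ x → List.map-cong (λ y → cong (λ b → if b then 1 else 0) (allDiv≡ x y)) N) N))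
  (sumN-grid-∧ P P N N)
  where N = upTo (prodV ds)

∣-eval : ∀ k q x y → k ∣ x → k ∣ y → k ∣ eval q x y
∣-eval k q x y k∣x k∣y = ℤ∣.∣⇒∣ᵤ (ℤ∣.∣m∣n⇒∣m+n (ℤ∣.∣m∣n⇒∣m+n
  (ℤ∣.∣m⇒∣m*n x (ℤ∣.∣n⇒∣m*n (a q) k∣ˢx))
  (ℤ∣.∣m⇒∣m*n y (ℤ∣.∣n⇒∣m*n ((+ 2) * b q) k∣ˢx)))
  (ℤ∣.∣m⇒∣m*n y (ℤ∣.∣n⇒∣m*n (c q) k∣ˢy)))
  where
  k∣ˢx : k ℤ∣.∣ x
  k∣ˢx = ℤ∣.∣ᵤ⇒∣ {k} {x} k∣x
  k∣ˢy : k ℤ∣.∣ y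
  k∣ˢy = ℤ∣.∣ᵤ⇒∣ {k} {y} k∣y

∤*⇒∤ˡ : ∀ k i j → ¬ k ∣ i * j → ¬ k ∣ i
∤*⇒∤ˡ k i j k∤ij k∣i = k∤ij (ℤ∣.∣⇒∣ᵤ (ℤ∣.∣m⇒∣m*n j (ℤ∣.∣ᵤ⇒∣ {k} {i} k∣i)))

∤*⇒∤ʳ : ∀ k i j → ¬ k ∣ i * j → ¬ k ∣ j
∤*⇒∤ʳ k i j k∤ij k∣j = k∤ij (ℤ∣.∣⇒∣ᵤ (ℤ∣.∣n⇒∣m*n i (ℤ∣.∣ᵤ⇒∣ {k} {j} k∣j)))

∣-combination : ∀ k f u h v → k ∣ u → k ∣ v → k ∣ f * u + h * v
∣-combination k f u h v k∣u k∣v = ℤ∣.∣⇒∣ᵤ (ℤ∣.∣m∣n⇒∣m+n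
  (ℤ∣.∣n⇒∣m*n f (ℤ∣.∣ᵤ⇒∣ {k} {u} k∣u)) (ℤ∣.∣n⇒∣m*n h (ℤ∣.∣ᵤ⇒∣ {k} {v} k∣v)))

-- Here q = A x² + B x y + C y² and r = a x² + b x y + c y²; the cofactors come from eliminating x (resp. y)
-- between q and r.
res-combination-y : ∀ (A B C a b c x y : ℤ) →
  ((a * (A * b - B * a)) * x + (C * a * a - B * a * b + A * b * b - A * a * c) * y)
    * (A * x * x + B * x * y + C * y * y)
  + ((A * (B * a - A * b)) * x + (B * B * a - A * C * a - A * B * b + A * A * c) * y)
    * (a * x * x + b * x * y + c * y * y)
  ≡ ((A * c - a * C) * (A * c - a * C) - (A * b - a * B) * (B * c - b * C)) * (y * y * y)
res-combination-y = solve-∀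

res-combination-x : ∀ (A B C a b c x y : ℤ) →
  ((A * c * c - B * c * b + C * b * b - C * c * a) * x + (c * (C * b - B * c)) * y)
    * (A * x * x + B * x * y + C * y * y)
  + ((B * B * c - C * A * c - C * B * b + C * C * a) * x + (C * (B * c - C * b)) * y)
    * (a * x * x + b * x * y + c * y * y)
  ≡ ((A * c - a * C) * (A * c - a * C) - (A * b - a * B) * (B * c - b * C)) * (x * x * x)
res-combination-x = solve-∀

divisorTuple : ∀ {n} → ℕ → Subset n → Vec ℕ n
divisorTuple d = Vec.map (λ side → if side then d else 1)

ωTerm : ∀ {g} → Vec BQF g → ℕ → Vec ℕ g → ℚ
ωTerm qs p cs = frac (μ p * Vec.foldr _ _*_ (+ 1) (Vec.map μ cs) * (+ ρ qs cs)) (prodV cs ℕ.* prodV cs)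

tuples-divisorTuple : ∀ d n → tuples n (1 ∷ d ∷ []) ≡ map (divisorTuple d) (subsets n)
tuples-divisorTuple d zero    = refl
tuples-divisorTuple d (suc n) = begin
  map (1 ∷_) Ts ++ (map (d ∷_) Ts ++ [])
    ≡⟨ cong (map (1 ∷_) Ts ++_) (List.++-identityʳ (map (d ∷_) Ts)) ⟩
  map (1 ∷_) Ts ++ map (d ∷_) Ts
    ≡⟨ cong₂ (λ xs ys → map (1 ∷_) xs ++ map (d ∷_) ys) (tuples-divisorTuple d n) (tuples-divisorTuple d n) ⟩
  map (1 ∷_) (map (divisorTuple d) S) ++ map (d ∷_) (map (divisorTuple d) S)
    ≡⟨ cong₂ _++_ (sym (List.map-∘ S)) (sym (List.map-∘ S)) ⟩
  map (divisorTuple d ∘ (outside ∷_)) S ++ map (divisorTuple d ∘ (inside ∷_)) S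
    ≡⟨ cong₂ _++_ (List.map-∘ S) (List.map-∘ S) ⟩
  map (divisorTuple d) (map (outside ∷_) S) ++ map (divisorTuple d) (map (inside ∷_) S)
    ≡⟨ sym (List.map-++ (divisorTuple d) (map (outside ∷_) S) _) ⟩
  map (divisorTuple d) (subsets (suc n)) ∎
  where
  open ≡-Reasoning
  S = subsets n
  Ts = tuples n (1 ∷ d ∷ [])

prodV-divisorTuple : ∀ d {n} (s : Subset n) → prodV (divisorTuple d s) ≡ d ℕ.^ card s
prodV-divisorTuple d Vec.[]        = refl
prodV-divisorTuple d (outside ∷ s) = trans (ℕ.*-identityˡ _) (prodV-divisorTuple d s)
prodV-divisorTuple d (inside ∷ s)  = cong (d ℕ.*_) (prodV-divisorTuple d s)

μ-product-divisorTuple : ∀ d {n} (s : Subset n) →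
  Vec.foldr _ _*_ 1ℤ (Vec.map μ (divisorTuple d s)) ≡ μ d ℤ.^ card s
μ-product-divisorTuple d Vec.[]        = refl
μ-product-divisorTuple d (outside ∷ s) = trans (ℤ.*-identityˡ _) (μ-product-divisorTuple d s)
μ-product-divisorTuple d (inside ∷ s)  = cong (μ d *_) (μ-product-divisorTuple d s)

divisorTuple-⁅⁆ : ∀ d {n} (i : Fin n) → divisorTuple d ⁅ i ⁆ ≡ e n i d
divisorTuple-⁅⁆ d {suc n} zero    = cong (d ∷_) (Vec.map-replicate _ outside n)
divisorTuple-⁅⁆ d {suc n} (suc i) = cong (1 ∷_) (divisorTuple-⁅⁆ d i)

prime⇒¬square∣ : ∀ {p} → Prime p → ∀ d .{{_ : ℕ.NonTrivial d}} → ¬ (d ℕ.* d) ℕ∣.∣ p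
prime⇒¬square∣ {p} p-prime@(prime notComposite) d dd∣p = notComposite (composite d<p (ℕ∣.∣-trans (ℕ∣.m∣m*n d) dd∣p))
  where
  instance
    _ = prime⇒nonZero p-prime
    _ = ℕ.nonTrivial⇒nonZero d
  d<p : d ℕ.< p
  d<p = ℕ.<-≤-trans (ℕ.m<m*n d d (ℕ.nonTrivial⇒n>1 d)) (ℕ∣.∣⇒≤ dd∣p)

divisors-prime : ∀ {p} → Prime p → divisors p ≡ 1 ∷ p ∷ []
divisors-prime {p@(suc (suc m))} (prime notComposite) = begin
  filter (_∣? p) (1 ∷ applyUpTo (λ k → suc (suc k)) (suc m))
    ≡⟨ List.filter-accept (_∣? p) (ℕ∣.1∣ p) ⟩
  1 ∷ filter (_∣? p) (applyUpTo (λ k → suc (suc k)) (suc m))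
    ≡⟨ cong (λ xs → 1 ∷ filter (_∣? p) xs) (sym (List.applyUpTo-∷ʳ (λ k → suc (suc k)) m)) ⟩
  1 ∷ filter (_∣? p) (applyUpTo (λ k → suc (suc k)) m ∷ʳ p)
    ≡⟨ cong (1 ∷_) (List.filter-++ (_∣? p) (applyUpTo (λ k → suc (suc k)) m) (p ∷ [])) ⟩
  1 ∷ (filter (_∣? p) (applyUpTo (λ k → suc (suc k)) m) ++ filter (_∣? p) (p ∷ []))
    ≡⟨ cong₂ (λ xs ys → 1 ∷ (xs ++ ys)) (List.filter-none (_∣? p) no-proper-divisor) (List.filter-accept (_∣? p) ℕ∣.∣-refl) ⟩
  1 ∷ p ∷ [] ∎
  where
  open ≡-Reasoning
  no-proper-divisor : All (λ d → ¬ d ℕ∣.∣ p) (applyUpTo (λ k → suc (suc k)) m)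
  no-proper-divisor = All.applyUpTo⁺₁ (λ k → suc (suc k)) m (λ i<m d∣p → notComposite (composite (ℕ.s≤s (ℕ.s≤s i<m)) d∣p))

μ-prime : ∀ {p} → Prime p → μ p ≡ -1ℤ
μ-prime {p} p-prime = begin
  μ p
    ≡⟨ cong (λ b → if b then 0ℤ else -1ℤ ℤ.^ List.length (filter prime? (divisors p))) (¬T⇒≡false square-free) ⟩
  -1ℤ ℤ.^ List.length (filter prime? (divisors p))
    ≡⟨ cong (λ ds → -1ℤ ℤ.^ List.length (filter prime? ds)) (divisors-prime p-prime) ⟩
  -1ℤ ℤ.^ List.length (filter prime? (1 ∷ p ∷ []))
    ≡⟨ cong (λ ds → -1ℤ ℤ.^ List.length ds) (trans (List.filter-reject prime? {1} {p ∷ []} ¬prime[1]) (List.filter-accept prime? {p} {[]} p-prime)) ⟩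
  -1ℤ ∎
  where
  open ≡-Reasoning
  square∣? : ℕ → Bool
  square∣? d = ⌊ (d ℕ.* d) ∣? p ⌋
  square-free : ¬ T (anyB square∣? (applyUpTo (λ k → suc (suc k)) p))
  square-free T-any with Any.applyUpTo⁻ (λ k → suc (suc k)) (Any.any⁻ square∣? (applyUpTo (λ k → suc (suc k)) p) T-any)
  ... | i , _ , T[dd∣p] = prime⇒¬square∣ p-prime d (toWitness {a? = (d ℕ.* d) ∣? p} T[dd∣p])
    where d = suc (suc i)

module _ {p : ℕ} (p-prime : Prime p) where

  private instance
    p≢0 : NonZero p
    p≢0 = prime⇒nonZero p-prime
    p*p≢0 : NonZero (p ℕ.* p)
    p*p≢0 = ℕ.m*n≢0 p p

  euclid-ℤ : ∀ i j → (+ p) ∣ i * j → (+ p) ∣ i ⊎ (+ p) ∣ j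
  euclid-ℤ i j p∣ij = euclidsLemma ℤ.∣ i ∣ ℤ.∣ j ∣ p-prime (subst (p ℕ∣.∣_) (ℤ.abs-* i j) p∣ij)

  ∣*cube⇒∣ : ∀ R z → ¬ (+ p) ∣ R → (+ p) ∣ R * (z * z * z) → (+ p) ∣ z
  ∣*cube⇒∣ R z p∤R p∣Rz³ with euclid-ℤ R _ p∣Rz³
  ... | inj₁ p∣R  = ⊥-elim (p∤R p∣R)
  ... | inj₂ p∣z³ with euclid-ℤ (z * z) z p∣z³
  ...   | inj₂ p∣z  = p∣z
  ...   | inj₁ p∣z² with euclid-ℤ z z p∣z²
  ...     | inj₁ p∣z = p∣z
  ...     | inj₂ p∣z = p∣z

  common-zero⇒∣x×∣y : ∀ q r x y → ¬ (+ p) ∣ res q r → (+ p) ∣ eval q x y → (+ p) ∣ eval r x y → (+ p) ∣ x × (+ p) ∣ y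
  common-zero⇒∣x×∣y q r x y p∤res p∣q p∣r =
    ∣*cube⇒∣ (res q r) x p∤res (subst ((+ p) ∣_) (res-combination-x A B C A′ B′ C′ x y)
                                       (∣-combination (+ p) fx (eval q x y) hx (eval r x y) p∣q p∣r)) ,
    ∣*cube⇒∣ (res q r) y p∤res (subst ((+ p) ∣_) (res-combination-y A B C A′ B′ C′ x y)
                                       (∣-combination (+ p) fy (eval q x y) hy (eval r x y) p∣q p∣r))
    where
    A = a q ; B = (+ 2) * b q ; C = c q
    A′ = a r ; B′ = (+ 2) * b r ; C′ = c r
    fx = (A * C′ * C′ - B * C′ * B′ + C * B′ * B′ - C * C′ * A′) * x + (C′ * (C * B′ - B * C′)) * y
    hx = (B * B * C′ - C * A * C′ - C * B * B′ + C * C * A′) * x + (C * (B * C′ - C * B′)) * y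
    fy = (A′ * (A * B′ - B * A′)) * x + (C * A′ * A′ - B * A′ * B′ + A * B′ * B′ - A * A′ * C′) * y
    hy = (A * (B * A′ - A * B′)) * x + (B * B * A′ - A * C * A′ - A * B * B′ + A * A * C′) * y

  allDiv-divisorTuple-∣ : ∀ {n} (qs : Vec BQF n) s {x y} → (+ p) ∣ x → (+ p) ∣ y → T (allDiv qs (divisorTuple p s) x y)
  allDiv-divisorTuple-∣ Vec.[]   Vec.[]        _   _   = _
  allDiv-divisorTuple-∣ (q ∷ qs) (outside ∷ s) {x} {y} p∣x p∣y with 1 ∣? ℤ.∣ eval q x y ∣
  ... | yes _  = allDiv-divisorTuple-∣ qs s p∣x p∣y
  ... | no 1∤q = 1∤q (ℕ∣.1∣ _)
  allDiv-divisorTuple-∣ (q ∷ qs) (inside ∷ s)  {x} {y} p∣x p∣y with p ∣? ℤ.∣ eval q x y ∣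
  ... | yes _  = allDiv-divisorTuple-∣ qs s p∣x p∣y
  ... | no p∤q = p∤q (∣-eval (+ p) q x y p∣x p∣y)

  common-zero-with : ∀ {n} q (qs : Vec BQF n) s {x y} → 1 ℕ.≤ card s → ¬ (+ p) ∣ prodZ (map (res q) (Vec.toList qs)) →
    (+ p) ∣ eval q x y → T (allDiv qs (divisorTuple p s) x y) → (+ p) ∣ x × (+ p) ∣ y
  common-zero-with q (r ∷ qs) (outside ∷ s) {x} {y} 1≤∣s∣ p∤res p∣q T-all with 1 ∣? ℤ.∣ eval r x y ∣
  ... | yes _ = common-zero-with q qs s 1≤∣s∣ (∤*⇒∤ʳ (+ p) (res q r) _ p∤res) p∣q T-all
  common-zero-with q (r ∷ qs) (inside ∷ s)  {x} {y} _     p∤res p∣q T-all with p ∣? ℤ.∣ eval r x y ∣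
  ... | yes p∣r = common-zero⇒∣x×∣y q r x y (∤*⇒∤ˡ (+ p) (res q r) _ p∤res) p∣q p∣r

  common-zero : ∀ {n} (qs : Vec BQF n) s {x y} → 2 ℕ.≤ card s → ¬ (+ p) ∣ resProd qs →
    T (allDiv qs (divisorTuple p s) x y) → (+ p) ∣ x × (+ p) ∣ y
  common-zero (q ∷ qs) (outside ∷ s) {x} {y} 2≤∣s∣ p∤R T-all with 1 ∣? ℤ.∣ eval q x y ∣
  ... | yes _ = common-zero qs s 2≤∣s∣ (∤*⇒∤ʳ (+ p) (prodZ (map (res q) (Vec.toList qs))) _ p∤R) T-all
  common-zero (q ∷ qs) (inside ∷ s)  {x} {y} (ℕ.s≤s 1≤∣s∣) p∤R T-all with p ∣? ℤ.∣ eval q x y ∣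
  ... | yes p∣q = common-zero-with q qs s 1≤∣s∣ (∤*⇒∤ˡ (+ p) (prodZ (map (res q) (Vec.toList qs))) _ p∤R) p∣q T-all

  ρ-divisorTuple-≥2 : ∀ {n} (qs : Vec BQF n) s j → card s ≡ 2 ℕ.+ j → ¬ (+ p) ∣ resProd qs →
    ρ qs (divisorTuple p s) ≡ p ℕ.^ suc j ℕ.* p ℕ.^ suc j
  ρ-divisorTuple-≥2 qs s j ∣s∣≡2+j p∤R = begin
    ρ qs (divisorTuple p s)
      ≡⟨ ρ-square qs (divisorTuple p s) (multipleOf p) allDiv≡ ⟩
    countWhere (multipleOf p) (upTo N) ℕ.* countWhere (multipleOf p) (upTo N)
      ≡⟨ cong (λ m → countWhere (multipleOf p) (upTo m) ℕ.* countWhere (multipleOf p) (upTo m)) N≡ ⟩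
    countWhere (multipleOf p) (upTo (p ℕ.^ suc j ℕ.* p)) ℕ.* countWhere (multipleOf p) (upTo (p ℕ.^ suc j ℕ.* p))
      ≡⟨ cong₂ ℕ._*_ (countWhere-multipleOf-upTo p (p ℕ.^ suc j)) (countWhere-multipleOf-upTo p (p ℕ.^ suc j)) ⟩
    p ℕ.^ suc j ℕ.* p ℕ.^ suc j ∎
    where
    open ≡-Reasoning
    N = prodV (divisorTuple p s)
    N≡ : N ≡ p ℕ.^ suc j ℕ.* p
    N≡ = trans (prodV-divisorTuple p s) (trans (cong (p ℕ.^_) ∣s∣≡2+j) (ℕ.*-comm p (p ℕ.^ suc j)))
    2≤∣s∣ : 2 ℕ.≤ card s
    2≤∣s∣ = subst (2 ℕ.≤_) (sym ∣s∣≡2+j) (ℕ.s≤s (ℕ.s≤s ℕ.z≤n))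
    allDiv≡ : ∀ x y → allDiv qs (divisorTuple p s) (+ x) (+ y) ≡ multipleOf p x ∧ multipleOf p y
    allDiv≡ x y with p ∣? x | p ∣? y
    ... | yes p∣x | yes p∣y = Equivalence.to T-≡ (allDiv-divisorTuple-∣ qs s p∣x p∣y)
    ... | no p∤x  | _       = ¬T⇒≡false (λ T-all → p∤x (proj₁ (common-zero qs s 2≤∣s∣ p∤R T-all)))
    ... | yes _   | no p∤y  = ¬T⇒≡false (λ T-all → p∤y (proj₂ (common-zero qs s 2≤∣s∣ p∤R T-all)))

  p∤1 : ¬ p ℕ∣.∣ 1
  p∤1 p∣1 = ℕ.nonTrivial⇒≢1 {{prime⇒nonTrivial p-prime}} (ℕ∣.∣1⇒≡1 p∣1)

  summand : ℕ → ℕ → ℚ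
  summand k r = if does (p ∣? p ℕ.^ k) then frac (-1ℤ * (-1ℤ ℤ.^ k) * + r) (p ℕ.^ k ℕ.* p ℕ.^ k) else 0ℚ

  filtered-ωTerm-divisorTuple : ∀ {n} (qs : Vec BQF n) s →
    (if does (p ∣? prodV (divisorTuple p s)) then ωTerm qs p (divisorTuple p s) else 0ℚ)
    ≡ summand (card s) (ρ qs (divisorTuple p s))
  filtered-ωTerm-divisorTuple qs s = cong₂ (λ N t → if does (p ∣? N) then t else 0ℚ) (prodV-divisorTuple p s) (cong₂ frac
    (cong₂ (λ u v → u * v * + ρ qs (divisorTuple p s))
           (μ-prime p-prime) (trans (μ-product-divisorTuple p s) (cong (ℤ._^ card s) (μ-prime p-prime))))
    (cong (λ m → m ℕ.* m) (prodV-divisorTuple p s)))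

  summand-0 : ∀ r → summand 0 r ≡ frac (weight 0 (+ r)) (p ℕ.* p)
  summand-0 r rewrite dec-false (p ∣? 1) p∤1 = sym (frac-0 (p ℕ.* p))

  summand-1 : ∀ r → summand 1 r ≡ frac (weight 1 (+ r)) (p ℕ.* p)
  summand-1 r rewrite dec-true (p ∣? p ℕ.^ 1) (ℕ∣.m∣m*n 1) =
    cong₂ frac (one-sign (+ r)) (cong (λ m → m ℕ.* m) (ℕ.*-identityʳ p))
    where
    one-sign : ∀ z → -1ℤ * (-1ℤ ℤ.^ 1) * z ≡ z + 0ℤ
    one-sign = solve-∀

  summand-≥2 : ∀ j → summand (2 ℕ.+ j) (p ℕ.^ suc j ℕ.* p ℕ.^ suc j) ≡ frac (sign≥2 (2 ℕ.+ j)) (p ℕ.* p)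
  summand-≥2 j rewrite dec-true (p ∣? p ℕ.^ suc (suc j)) (ℕ∣.m∣m*n (p ℕ.^ suc j)) = begin
    frac (-1ℤ * σ * + (P ℕ.* P)) ((p ℕ.* P) ℕ.* (p ℕ.* P))
      ≡⟨ cong (frac (-1ℤ * σ * + (P ℕ.* P))) (ℕ.[m*n]*[o*p]≡[m*o]*[n*p] p P p P) ⟩
    frac (-1ℤ * σ * + (P ℕ.* P)) ((p ℕ.* p) ℕ.* (P ℕ.* P))
      ≡⟨ frac-*-cancelʳ (-1ℤ * σ) (P ℕ.* P) (p ℕ.* p) ⟩
    frac (-1ℤ * σ) (p ℕ.* p)
      ≡⟨ cong (λ z → frac z (p ℕ.* p)) (ℤ.-1*i≡-i σ) ⟩
    frac (- σ) (p ℕ.* p) ∎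
    where
    open ≡-Reasoning
    P = p ℕ.^ suc j
    σ = -1ℤ ℤ.^ suc (suc j)
    instance
      P*P≢0 : NonZero (P ℕ.* P)
      P*P≢0 = ℕ.m*n≢0 P P {{ℕ.m^n≢0 p (suc j)}} {{ℕ.m^n≢0 p (suc j)}}

  summand-divisorTuple : ∀ {n} (qs : Vec BQF n) → ¬ (+ p) ∣ resProd qs → ∀ s →
    summand (card s) (ρ qs (divisorTuple p s)) ≡ frac (weight (card s) (+ ρ qs (divisorTuple p s))) (p ℕ.* p)
  summand-divisorTuple qs p∤R s with card s in ∣s∣≡
  ... | zero        = summand-0 (ρ qs (divisorTuple p s))
  ... | suc zero    = summand-1 (ρ qs (divisorTuple p s))
  ... | suc (suc j) = trans (cong (summand (2 ℕ.+ j)) (ρ-divisorTuple-≥2 qs s j ∣s∣≡ p∤R))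
                            (trans (summand-≥2 j) (cong (λ z → frac z (p ℕ.* p)) (sym (ℤ.+-identityˡ _))))

  ω-prime : ∀ {n} (qs : Vec BQF (suc n)) → ¬ (+ p) ∣ resProd qs →
    ω qs p ≡ frac (sumZ (map (λ i → + ρ qs (e (suc n) i p)) (allFin (suc n))) + + 1 - + suc n) p
  ω-prime {n} qs p∤R = begin
    ω qs p
      ≡⟨⟩
    (+ p / 1) ℚ.* sumQ (map (ωTerm qs p) (filter (λ cs → p ∣? prodV cs) (tuples (suc n) (divisors p))))
      ≡⟨ cong (λ ts → (+ p / 1) ℚ.* sumQ (map (ωTerm qs p) (filter (λ cs → p ∣? prodV cs) ts)))
              (trans (cong (tuples (suc n)) (divisors-prime p-prime)) (tuples-divisorTuple p (suc n))) ⟩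
    (+ p / 1) ℚ.* sumQ (map (ωTerm qs p) (filter (λ cs → p ∣? prodV cs) (map (divisorTuple p) S)))
      ≡⟨ cong ((+ p / 1) ℚ.*_) (sumQ-filter (λ cs → p ∣? prodV cs) (ωTerm qs p) (map (divisorTuple p) S)) ⟩
    (+ p / 1) ℚ.* sumQ (map (λ cs → if does (p ∣? prodV cs) then ωTerm qs p cs else 0ℚ) (map (divisorTuple p) S))
      ≡⟨ cong (λ ts → (+ p / 1) ℚ.* sumQ ts) (trans (sym (List.map-∘ S)) (List.map-cong per-subset S)) ⟩
    (+ p / 1) ℚ.* sumQ (map (λ s → frac (weight (card s) (h s)) (p ℕ.* p)) S)
      ≡⟨ cong ((+ p / 1) ℚ.*_) (sumQ-frac (λ s → weight (card s) (h s)) (p ℕ.* p) S) ⟩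
    (+ p / 1) ℚ.* frac (sumZ (map (λ s → weight (card s) (h s)) S)) (p ℕ.* p)
      ≡⟨ *-frac-cancelˡ _ p p ⟩
    frac (sumZ (map (λ s → weight (card s) (h s)) S)) p
      ≡⟨ cong (λ z → frac z p) (sumZ-subsets-weight n h) ⟩
    frac (sumZ (map (h ∘ ⁅_⁆) (allFin (suc n))) + + 1 - + suc n) p
      ≡⟨ cong (λ z → frac (sumZ z + + 1 - + suc n) p) (List.map-cong (λ i → cong (λ c → + ρ qs c) (divisorTuple-⁅⁆ p i)) (allFin (suc n))) ⟩
    frac (sumZ (map (λ i → + ρ qs (e (suc n) i p)) (allFin (suc n))) + + 1 - + suc n) p ∎
    where
    open ≡-Reasoning
    S = subsets (suc n)
    h : Subset (suc n) → ℤ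
    h s = + ρ qs (divisorTuple p s)
    per-subset : ∀ s → (if does (p ∣? prodV (divisorTuple p s)) then ωTerm qs p (divisorTuple p s) else 0ℚ)
                       ≡ frac (weight (card s) (h s)) (p ℕ.* p)
    per-subset s = trans (filtered-ωTerm-divisorTuple qs s) (summand-divisorTuple qs p∤R s)

lemma12 : (g : ℕ) → 2 ≤ g → (qs : Vec BQF g) →
    (∀ (i : Fin g) → Irreducible (lookup qs i)) →
    (∀ (i : Fin g) → (+ 4) ∣ (a (lookup qs i) - + 1)) →
    D g qs ≢ + 0 →
    (p : ℕ) → Prime p → ¬ ((+ p) ∣ D g qs) →
    ω qs p ≡ frac (sumZ (map (λ i → + ρ qs (e g i p)) (allFin g)) + + 1 - + g) p
lemma12 (suc g) _ qs _ _ _ p p-prime p∤D =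
  ω-prime p-prime qs (∤*⇒∤ʳ (+ p) (+ primorial (2 ℕ.* suc g) * acdProd qs) (resProd qs) p∤D)
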